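{- Let $k\geq 2$ and let $G$ be a complete $k$-partite graph with vertex partition $\{V_1,\dots,V_k\}$. If there exists $i\in[k]$ such that $|V_i|\geq 2^{|V(G)\setminus V_i|}$, then $\mathrm{tp}_2(G)\geq \left\lfloor |V_i|/2^{|V(G)\setminus V_i|}\right\rfloor$. In particular, for all integers $t\geq 1$ and $k\geq 2$, there exists a complete $k$-partite graph $G$ with $\mathrm{tp}_2(G)>t$.
   Context: $\mathrm{tp}_2(G)$ is the minimum integer $t$ such that for every coloring of the edges of $G$ with $2$ colors, there exist at most $t$ monochromatic connected subgraphs of $G$ whose vertex sets are pairwise disjoint and cover $V(G)$. Graphs are finite. -}

module Defs where

open import Data.Nat using (ℕ; zero; suc; _+_; _∸_; _^_; _≤_; _<_; NonZero)
open import Data.Nat.Properties using (m^n≢0)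
open import Data.Nat.DivMod using (_/_)
open import Data.Fin using (Fin; _≟_)
open import Data.Bool using (Bool)
open import Data.Product using (Σ; _×_; ∃)
open import Relation.Binary.PropositionalEquality using (_≡_; _≢_)
open import Relation.Nullary using (yes; no)

-- The complete k-partite graph on vertex set Fin n whose parts are the
-- fibres of the part-assignment p : Fin n → Fin k.  Two vertices are adjacent
-- iff they lie in different parts.
Adj : ∀ {n k} → (Fin n → Fin k) → Fin n → Fin n → Set
Adj p u v = p u ≢ p v

PartsNonempty : ∀ {n k} → (Fin n → Fin k) → Set
PartsNonempty {n} {k} p = (i : Fin k) → ∃ λ (v : Fin n) → p v ≡ i

-- A 2-edge-colouring: a colour for each (unordered) edge, given as a
-- symmetric function on ordered pairs (values on non-edges are irrelevant).
record Colouring (n : ℕ) : Set where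
  field
    col : Fin n → Fin n → Bool
    sym : ∀ u v → col u v ≡ col v u

data Walk {n k s : ℕ} (p : Fin n → Fin k) (c : Colouring n)
          (f : Fin n → Fin s) (j : Fin s) (γ : Bool) : Fin n → Fin n → Set where
  here : ∀ {u} → Walk p c f j γ u u
  step : ∀ {u v w} → Adj p u v → Colouring.col c u v ≡ γ → f v ≡ j →
         Walk p c f j γ v w → Walk p c f j γ u w

-- A partition of V(G) into s pairwise disjoint vertex sets (vertex v lies in
-- set part v), each spanning a connected subgraph of G all of whose edges
-- have colour (colour j): a cover by s vertex-disjoint monochromatic
-- connected subgraphs.
record MonoPartition {n k : ℕ} (p : Fin n → Fin k) (c : Colouring n) (s : ℕ) : Set where
  field
    part      : Fin n → Fin s
    colour    : Fin s → Bool
    nonempty  : (j : Fin s) → ∃ λ v → part v ≡ j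
    connected : (j : Fin s) (u v : Fin n) → part u ≡ j → part v ≡ j →
                Walk p c part j (colour j) u v

Tp2Works : ∀ {n k} → (Fin n → Fin k) → ℕ → Set
Tp2Works {n} p t = (c : Colouring n) → Σ ℕ λ s → s ≤ t × MonoPartition p c s

-- tp₂(G) ≥ m : every t that works is at least m (tp₂ is the least such t).
Tp2≥ : ∀ {n k} → (Fin n → Fin k) → ℕ → Set
Tp2≥ p m = (t : ℕ) → Tp2Works p t → m ≤ t

countFib : ∀ {n k} → (Fin n → Fin k) → Fin k → ℕ
countFib {zero}  q i = 0
countFib {suc n} q i with q Fin.zero ≟ i
... | yes _ = suc (countFib (λ x → q (Fin.suc x)) i)
... | no  _ = countFib (λ x → q (Fin.suc x)) i

partSize : ∀ {n k} → (Fin n → Fin k) → Fin k → ℕ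
partSize = countFib

div2^ : ℕ → ℕ → ℕ
div2^ a e = _/_ a (2 ^ e) {{m^n≢0 2 e}}

{-# OPTIONS --safe #-}
-- Write B = V(G) ∖ Vᵢ and b = |B|.  Number the vertices of Vᵢ and colour the edge
-- between the vertex of rank r and the y-th vertex of B by the y-th binary digit of r;
-- edges inside B get any colour.  Given a cover by monochromatic connected pieces,
-- let g(y) be the opposite of the colour of the piece containing the y-th vertex
-- of B.  A vertex of Vᵢ whose digits are g sends every edge into the wrong colour
-- for the piece at its other end, so it forms a piece on its own.  Among ranks
-- below |Vᵢ| there are ⌊|Vᵢ|/2^b⌋ numbers with digits g, giving that many
-- distinct pieces.
module Submission where

open import Defs
open import Data.Nat using (ℕ; zero; suc; _+_; _*_; _≤_; _<_; _∸_; _^_; ⌊_/2⌋; z≤n; s≤s)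
open import Data.Nat.Properties hiding (_≟_)
open import Data.Nat.DivMod using (m/n*n≤m)
open import Data.Nat.Solver using (module +-*-Solver)
open import Data.Fin using (Fin; toℕ; fromℕ<; _≟_; splitAt; join; _↑ˡ_; _↑ʳ_)
open import Data.Fin.Properties using (toℕ-fromℕ<; toℕ-injective; toℕ<n; injective⇒≤; splitAt-↑ˡ; splitAt-↑ʳ; join-splitAt)
open import Data.Bool using (Bool; true; false; not)
open import Data.Bool.Properties using (not-¬)
open import Data.Sum using (inj₁; inj₂; [_,_]′)
open import Data.Product using (Σ; _×_; _,_)
open import Data.Empty using (⊥-elim; ⊥-elim-irr)
open import Function using (_∘_)
open import Relation.Nullary using (yes; no)
open import Relation.Binary.PropositionalEquality

bit : Bool → ℕ
bit false = 0
bit true  = 1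

isOdd : ℕ → Bool
isOdd zero          = false
isOdd (suc zero)    = true
isOdd (suc (suc n)) = isOdd n

isOdd[bit+2*z]≡bit : ∀ x z → isOdd (bit x + 2 * z) ≡ x
isOdd[bit+2*z]≡bit false zero = refl
isOdd[bit+2*z]≡bit true  zero = refl
isOdd[bit+2*z]≡bit x (suc z)
  rewrite *-suc 2 z | +-suc (bit x) (suc (2 * z)) | +-suc (bit x) (2 * z) = isOdd[bit+2*z]≡bit x z

⌊bit+2*z/2⌋≡z : ∀ x z → ⌊ bit x + 2 * z /2⌋ ≡ z
⌊bit+2*z/2⌋≡z false zero = refl
⌊bit+2*z/2⌋≡z true  zero = refl
⌊bit+2*z/2⌋≡z x (suc z)
  rewrite *-suc 2 z | +-suc (bit x) (suc (2 * z)) | +-suc (bit x) (2 * z) = cong suc (⌊bit+2*z/2⌋≡z x z)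

toBits : (b : ℕ) → ℕ → Fin b → Bool
toBits (suc b) r Fin.zero    = isOdd r
toBits (suc b) r (Fin.suc y) = toBits b ⌊ r /2⌋ y

fromBits : (b : ℕ) → (Fin b → Bool) → ℕ
fromBits zero    g = 0
fromBits (suc b) g = bit (g Fin.zero) + 2 * fromBits b (g ∘ Fin.suc)

fromBits<2^ : ∀ b g → fromBits b g < 2 ^ b
fromBits<2^ zero    g = s≤s z≤n
fromBits<2^ (suc b) g = begin-strict
    bit (g Fin.zero) + 2 * e  ≤⟨ +-monoˡ-≤ (2 * e) (bit≤1 (g Fin.zero)) ⟩
    1 + 2 * e                 <⟨ n<1+n _ ⟩
    2 + 2 * e                 ≡⟨ *-suc 2 e ⟨
    2 * suc e                 ≤⟨ *-monoʳ-≤ 2 (fromBits<2^ b (g ∘ Fin.suc)) ⟩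
    2 * 2 ^ b                 ∎
  where
  open ≤-Reasoning
  e = fromBits b (g ∘ Fin.suc)
  bit≤1 : ∀ x → bit x ≤ 1
  bit≤1 false = z≤n
  bit≤1 true  = s≤s z≤n

toBits[j*2^b+fromBits[g]]≡g : ∀ b j g y → toBits b (j * 2 ^ b + fromBits b g) y ≡ g y
toBits[j*2^b+fromBits[g]]≡g (suc b) j g y =
  trans (cong (λ r → toBits (suc b) r y) (regroup j (2 ^ b) (bit (g Fin.zero)) e)) (digits y)
  where
  open +-*-Solver
  regroup : ∀ j m x e → j * (2 * m) + (x + 2 * e) ≡ x + 2 * (j * m + e)
  regroup = solve 4 (λ j m x e → j :* (con 2 :* m) :+ (x :+ con 2 :* e) := x :+ con 2 :* (j :* m :+ e)) refl
  e = fromBits b (g ∘ Fin.suc)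
  digits : ∀ y → toBits (suc b) (bit (g Fin.zero) + 2 * (j * 2 ^ b + e)) y ≡ g y
  digits Fin.zero     = isOdd[bit+2*z]≡bit (g Fin.zero) (j * 2 ^ b + e)
  digits (Fin.suc y′) = trans (cong (λ r → toBits b r y′) (⌊bit+2*z/2⌋≡z (g Fin.zero) (j * 2 ^ b + e)))
                              (toBits[j*2^b+fromBits[g]]≡g b j (g ∘ Fin.suc) y′)

record RankedPart {n k : ℕ} (q : Fin n → Fin k) (i : Fin k) (c : ℕ) : Set where
  field
    member      : Fin c → Fin n
    member-∈    : ∀ x → q (member x) ≡ i
    rank        : Fin n → ℕ
    rank-member : ∀ x → rank (member x) ≡ toℕ x

record IndexedComplement {n k : ℕ} (q : Fin n → Fin k) (i : Fin k) (b : ℕ) : Set where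
  field
    index        : (w : Fin n) → .(q w ≢ i) → Fin b
    vertex       : Fin b → Fin n
    vertex-index : ∀ w .(w∉ : q w ≢ i) → vertex (index w w∉) ≡ w

rankedFibre : ∀ {n k} (q : Fin n → Fin k) i → RankedPart q i (countFib q i)
rankedFibre {zero} q i = record { member = λ () ; member-∈ = λ () ; rank = λ () ; rank-member = λ () }
rankedFibre {suc n} q i with q Fin.zero ≟ i
... | yes q0≡i = record { member = member′ ; member-∈ = member′-∈ ; rank = rank′ ; rank-member = rank′-member′ }
  where
  open RankedPart (rankedFibre (q ∘ Fin.suc) i)
  member′ : Fin (suc (countFib (q ∘ Fin.suc) i)) → Fin (suc n)
  member′ Fin.zero    = Fin.zero
  member′ (Fin.suc x) = Fin.suc (member x)
  member′-∈ : ∀ x → q (member′ x) ≡ i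
  member′-∈ Fin.zero    = q0≡i
  member′-∈ (Fin.suc x) = member-∈ x
  rank′ : Fin (suc n) → ℕ
  rank′ Fin.zero    = 0
  rank′ (Fin.suc w) = suc (rank w)
  rank′-member′ : ∀ x → rank′ (member′ x) ≡ toℕ x
  rank′-member′ Fin.zero    = refl
  rank′-member′ (Fin.suc x) = cong suc (rank-member x)
... | no _ = record { member = Fin.suc ∘ member ; member-∈ = member-∈ ; rank = rank′ ; rank-member = rank-member }
  where
  open RankedPart (rankedFibre (q ∘ Fin.suc) i)
  rank′ : Fin (suc n) → ℕ
  rank′ Fin.zero    = 0
  rank′ (Fin.suc w) = rank w

countNot : ∀ {n k} → (Fin n → Fin k) → Fin k → ℕ
countNot {zero}  q i = 0
countNot {suc n} q i with q Fin.zero ≟ i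
... | yes _ = countNot (q ∘ Fin.suc) i
... | no  _ = suc (countNot (q ∘ Fin.suc) i)

countFib+countNot≡n : ∀ {n k} (q : Fin n → Fin k) i → countFib q i + countNot q i ≡ n
countFib+countNot≡n {zero}  q i = refl
countFib+countNot≡n {suc n} q i with q Fin.zero ≟ i
... | yes _ = cong suc (countFib+countNot≡n (q ∘ Fin.suc) i)
... | no  _ = trans (+-suc _ _) (cong suc (countFib+countNot≡n (q ∘ Fin.suc) i))

indexedComplement : ∀ {n k} (q : Fin n → Fin k) i → IndexedComplement q i (countNot q i)
indexedComplement {zero} q i = record { index = λ () ; vertex = λ () ; vertex-index = λ () }
indexedComplement {suc n} q i with q Fin.zero ≟ i
... | yes q0≡i = record { index = index′ ; vertex = Fin.suc ∘ vertex ; vertex-index = vertex-index′ }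
  where
  open IndexedComplement (indexedComplement (q ∘ Fin.suc) i)
  index′ : (w : Fin (suc n)) → .(q w ≢ i) → Fin (countNot (q ∘ Fin.suc) i)
  index′ Fin.zero    w∉ = ⊥-elim-irr (w∉ q0≡i)
  index′ (Fin.suc w) w∉ = index w w∉
  vertex-index′ : ∀ w .(w∉ : q w ≢ i) → Fin.suc (vertex (index′ w w∉)) ≡ w
  vertex-index′ Fin.zero    w∉ = ⊥-elim-irr (w∉ q0≡i)
  vertex-index′ (Fin.suc w) w∉ = cong Fin.suc (vertex-index w w∉)
... | no _ = record { index = index′ ; vertex = vertex′ ; vertex-index = vertex-index′ }
  where
  open IndexedComplement (indexedComplement (q ∘ Fin.suc) i)
  index′ : (w : Fin (suc n)) → .(q w ≢ i) → Fin (suc (countNot (q ∘ Fin.suc) i))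
  index′ Fin.zero    _  = Fin.zero
  index′ (Fin.suc w) w∉ = Fin.suc (index w w∉)
  vertex′ : Fin (suc (countNot (q ∘ Fin.suc) i)) → Fin (suc n)
  vertex′ Fin.zero    = Fin.zero
  vertex′ (Fin.suc y) = Fin.suc (vertex y)
  vertex-index′ : ∀ w .(w∉ : q w ≢ i) → vertex′ (index′ w w∉) ≡ w
  vertex-index′ Fin.zero    _  = refl
  vertex-index′ (Fin.suc w) w∉ = cong Fin.suc (vertex-index w w∉)

module BinaryColouring {n k c b : ℕ} {p : Fin n → Fin k} {i : Fin k}
                       (R : RankedPart p i c) (I : IndexedComplement p i b) where
  open RankedPart R
  open IndexedComplement I

  label : Fin n → Fin b → Bool
  label a = toBits b (rank a)

  edgeColour : Fin n → Fin n → Bool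
  edgeColour u v with p u ≟ i | p v ≟ i
  ... | yes _ | no v∉  = label u (index v v∉)
  ... | no u∉ | yes _  = label v (index u u∉)
  ... | _     | _      = false

  edgeColour-sym : ∀ u v → edgeColour u v ≡ edgeColour v u
  edgeColour-sym u v with p u ≟ i | p v ≟ i
  ... | yes _ | yes _ = refl
  ... | yes _ | no _  = refl
  ... | no _  | yes _ = refl
  ... | no _  | no _  = refl

  binaryColouring : Colouring n
  binaryColouring = record { col = edgeColour ; sym = edgeColour-sym }

  edgeColour-cross : ∀ {a w} → p a ≡ i → (w∉ : p w ≢ i) → edgeColour a w ≡ label a (index w w∉)
  edgeColour-cross {a} {w} a∈ w∉ with p a ≟ i | p w ≟ i
  ... | no a∉ | _     = ⊥-elim (a∉ a∈)
  ... | yes _ | yes w∈ = ⊥-elim (w∉ w∈)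
  ... | yes _ | no _   = refl

  module _ {s : ℕ} (P : MonoPartition p binaryColouring s) where
    open MonoPartition P

    antiLabel : Fin b → Bool
    antiLabel y = not (colour (part (vertex y)))

    antiLabelled-walk-trivial : ∀ {j a v} → p a ≡ i → (∀ y → label a y ≡ antiLabel y) →
                                Walk p binaryColouring part j (colour j) a v → a ≡ v
    antiLabelled-walk-trivial a∈ a-anti here = refl
    antiLabelled-walk-trivial {j} {a} a∈ a-anti (step {v = w} a≁w aw-colour w-in-j _) =
      ⊥-elim (not-¬ refl (begin
        colour j                                ≡⟨ aw-colour ⟨
        edgeColour a w                          ≡⟨ edgeColour-cross a∈ w∉ ⟩
        label a (index w w∉)                    ≡⟨ a-anti (index w w∉) ⟩
        not (colour (part (vertex (index w w∉)))) ≡⟨ cong (not ∘ colour ∘ part) (vertex-index w w∉) ⟩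
        not (colour (part w))                   ≡⟨ cong (not ∘ colour) w-in-j ⟩
        not (colour j)                          ∎))
      where
      open ≡-Reasoning
      w∉ : p w ≢ i
      w∉ w∈ = a≁w (trans a∈ (sym w∈))

    module _ {m : ℕ} (m*2^b≤c : m * 2 ^ b ≤ c) where

      antiRank<c : (j : Fin m) → toℕ j * 2 ^ b + fromBits b antiLabel < c
      antiRank<c j = begin-strict
        toℕ j * 2 ^ b + fromBits b antiLabel  <⟨ +-monoʳ-< (toℕ j * 2 ^ b) (fromBits<2^ b antiLabel) ⟩
        toℕ j * 2 ^ b + 2 ^ b                 ≡⟨ +-comm (toℕ j * 2 ^ b) (2 ^ b) ⟩
        suc (toℕ j) * 2 ^ b                   ≤⟨ *-monoˡ-≤ (2 ^ b) (toℕ<n j) ⟩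
        m * 2 ^ b                             ≤⟨ m*2^b≤c ⟩
        c                                     ∎
        where open ≤-Reasoning

      antiLabelled : Fin m → Fin n
      antiLabelled j = member (fromℕ< (antiRank<c j))

      rank-antiLabelled : ∀ j → rank (antiLabelled j) ≡ toℕ j * 2 ^ b + fromBits b antiLabel
      rank-antiLabelled j = trans (rank-member _) (toℕ-fromℕ< (antiRank<c j))

      label-antiLabelled : ∀ j y → label (antiLabelled j) y ≡ antiLabel y
      label-antiLabelled j y rewrite rank-antiLabelled j = toBits[j*2^b+fromBits[g]]≡g b (toℕ j) antiLabel y

      part∘antiLabelled-injective : ∀ {j j′} → part (antiLabelled j) ≡ part (antiLabelled j′) → j ≡ j′
      part∘antiLabelled-injective {j} {j′} same-part =
        toℕ-injective (*-cancelʳ-≡ (toℕ j) (toℕ j′) (2 ^ b) {{m^n≢0 2 b}}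
          (+-cancelʳ-≡ (fromBits b antiLabel) _ _ (begin
            toℕ j * 2 ^ b + fromBits b antiLabel   ≡⟨ rank-antiLabelled j ⟨
            rank (antiLabelled j)                  ≡⟨ cong rank same-vertex ⟩
            rank (antiLabelled j′)                 ≡⟨ rank-antiLabelled j′ ⟩
            toℕ j′ * 2 ^ b + fromBits b antiLabel  ∎)))
        where
        open ≡-Reasoning
        same-vertex : antiLabelled j ≡ antiLabelled j′
        same-vertex = antiLabelled-walk-trivial (member-∈ _) (label-antiLabelled j)
          (connected _ (antiLabelled j) (antiLabelled j′) refl (sym same-part))

      m≤s : m ≤ s
      m≤s = injective⇒≤ part∘antiLabelled-injective

tp₂≥-of-large-part : ∀ {n k c b m} {p : Fin n → Fin k} {i : Fin k} →
                     RankedPart p i c → IndexedComplement p i b → m * 2 ^ b ≤ c → Tp2≥ p m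
tp₂≥-of-large-part R I m*2^b≤c t works with works (BinaryColouring.binaryColouring R I)
... | s , s≤t , P = ≤-trans (BinaryColouring.m≤s R I P m*2^b≤c) s≤t

tp₂≥⌊|Vᵢ|/2^|V∖Vᵢ|⌋ : ∀ {n k} (p : Fin n → Fin k) (i : Fin k) →
                      Tp2≥ p (div2^ (partSize p i) (n ∸ partSize p i))
tp₂≥⌊|Vᵢ|/2^|V∖Vᵢ|⌋ {n} p i =
  subst (λ b → Tp2≥ p (div2^ (partSize p i) b)) (sym |V∖Vᵢ|≡countNot)
    (tp₂≥-of-large-part (rankedFibre p i) (indexedComplement p i)
      (m/n*n≤m (partSize p i) (2 ^ countNot p i) {{m^n≢0 2 (countNot p i)}}))
  where
  |V∖Vᵢ|≡countNot : n ∸ partSize p i ≡ countNot p i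
  |V∖Vᵢ|≡countNot = trans (cong (_∸ partSize p i) (sym (countFib+countNot≡n p i)))
                          (m+n∸m≡n (partSize p i) (countNot p i))

oneLargePart : (N K : ℕ) → Fin (N + K) → Fin (suc K)
oneLargePart N K w = [ (λ _ → Fin.zero) , Fin.suc ]′ (splitAt N w)

oneLargePart-nonempty : ∀ {N} K → 0 < N → PartsNonempty (oneLargePart N K)
oneLargePart-nonempty {N} K N>0 Fin.zero =
  fromℕ< N>0 ↑ˡ K , cong [ (λ _ → Fin.zero) , Fin.suc ]′ (splitAt-↑ˡ N (fromℕ< N>0) K)
oneLargePart-nonempty {N} K _ (Fin.suc y) =
  N ↑ʳ y , cong [ (λ _ → Fin.zero) , Fin.suc ]′ (splitAt-↑ʳ N K y)

rankedLargePart : ∀ N K → RankedPart (oneLargePart N K) Fin.zero N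
rankedLargePart N K = record
  { member      = _↑ˡ K
  ; member-∈    = λ x → cong [ (λ _ → Fin.zero) , Fin.suc ]′ (splitAt-↑ˡ N x K)
  ; rank        = λ w → [ toℕ , (λ _ → 0) ]′ (splitAt N w)
  ; rank-member = λ x → cong [ toℕ , (λ _ → 0) ]′ (splitAt-↑ˡ N x K)
  }

indexedSingletons : ∀ N K → IndexedComplement (oneLargePart N K) Fin.zero K
indexedSingletons N K = record { index = index ; vertex = N ↑ʳ_ ; vertex-index = vertex-index }
  where
  index : (w : Fin (N + K)) → .(oneLargePart N K w ≢ Fin.zero) → Fin K
  index w w∉ with splitAt N w
  ... | inj₁ _ = ⊥-elim-irr (w∉ refl)
  ... | inj₂ y = y
  vertex-index : ∀ w .(w∉ : oneLargePart N K w ≢ Fin.zero) → N ↑ʳ index w w∉ ≡ w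
  vertex-index w w∉ with splitAt N w in split≡
  ... | inj₁ _ = ⊥-elim-irr (w∉ refl)
  ... | inj₂ y = trans (cong (join N K) (sym split≡)) (join-splitAt N K w)

corollary6p10 :
    ((n k : ℕ) → 2 ≤ k → (p : Fin n → Fin k) → PartsNonempty p →
      (i : Fin k) → 2 ^ (n ∸ partSize p i) ≤ partSize p i →
      Tp2≥ p (div2^ (partSize p i) (n ∸ partSize p i)))
    ×
    ((t k : ℕ) → 1 ≤ t → 2 ≤ k →
      Σ ℕ λ n → Σ (Fin n → Fin k) λ p → PartsNonempty p × Tp2≥ p (suc t))
-- The bound holds for every part; the size hypothesis only makes it nontrivial.
corollary6p10 = (λ n k _ p _ i _ → tp₂≥⌊|Vᵢ|/2^|V∖Vᵢ|⌋ p i) , unbounded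
  where
  unbounded : (t k : ℕ) → 1 ≤ t → 2 ≤ k →
              Σ ℕ λ n → Σ (Fin n → Fin k) λ p → PartsNonempty p × Tp2≥ p (suc t)
  unbounded t (suc K) _ _ =
    N + K , oneLargePart N K , oneLargePart-nonempty K (<-≤-trans (m^n>0 2 K) (m≤m+n (2 ^ K) (t * 2 ^ K))) ,
    tp₂≥-of-large-part (rankedLargePart N K) (indexedSingletons N K) ≤-refl
    where N = suc t * 2 ^ K
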